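{- If Maker makes the first move, then Breaker cannot win the connectivity game $\mathcal{C}(E_b,n)$, even with the maximal matching bias $b=\lfloor n/2\rfloor$ (and hence for any $b\le\lfloor n/2\rfloor$).
   Context: $\mathcal{C}(E_b,n)$ is the following game on the edge set of $K_n$: players alternate; on each turn Maker claims one unclaimed edge, and Breaker claims a set of at most $b$ pairwise vertex-disjoint unclaimed edges. The game ends when no unclaimed edges remain. Maker wins if her graph contains a spanning tree of $K_n$; otherwise Breaker wins. -}

module Defs where

open import Data.Nat using (ℕ; _≤_)
open import Data.Fin using (Fin; _<_)
open import Data.Product using (_×_; _,_; Σ; ∃)
open import Data.Sum using (_⊎_)
open import Data.List using (List; []; _∷_; length; _++_)
open import Data.List.Membership.Propositional using (_∈_; _∉_)
open import Data.List.Relation.Unary.All using (All)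
open import Data.List.Relation.Unary.AllPairs using (AllPairs)
open import Relation.Binary.PropositionalEquality using (_≢_)

-- An edge of K_n is an ordered pair (u , v) of vertices with u < v
-- (the normal form of the unordered pair {u , v}).
Edge : ℕ → Set
Edge n = Fin n × Fin n

IsEdge : ∀ {n} → Edge n → Set
IsEdge (u , v) = u < v

Graph : ℕ → Set
Graph n = List (Edge n)

data Reach {n : ℕ} (G : Graph n) : Fin n → Fin n → Set where
  here : ∀ {x} → Reach G x x
  fwd  : ∀ {x y z} → (x , y) ∈ G → Reach G y z → Reach G x z
  bwd  : ∀ {x y z} → (y , x) ∈ G → Reach G y z → Reach G x z

-- G is connected (= contains a spanning tree of K_n).
Connected : ∀ {n} → Graph n → Set
Connected {n} G = (x y : Fin n) → Reach G x y

Unclaimed : ∀ {n} → Graph n → Graph n → Edge n → Set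
Unclaimed M B e = IsEdge e × e ∉ M × e ∉ B

AllClaimed : ∀ {n} → Graph n → Graph n → Set
AllClaimed {n} M B = (e : Edge n) → IsEdge e → e ∈ M ⊎ e ∈ B

Disjoint : ∀ {n} → Edge n → Edge n → Set
Disjoint (a , b) (c , d) = a ≢ c × a ≢ d × b ≢ c × b ≢ d

-- A legal Breaker move with bias b: a set of at most b pairwise
-- vertex-disjoint unclaimed edges (pairwise disjointness forces distinctness).
BreakerMove : ∀ {n} → ℕ → Graph n → Graph n → List (Edge n) → Set
BreakerMove b M B S =
  length S ≤ b × All (Unclaimed M B) S × AllPairs Disjoint S

-- MakerWinsM b M B : Maker, to move at position (M , B), has a strategy
-- guaranteeing that her final graph is connected, whatever Breaker does.
-- MakerWinsB b M B : same, with Breaker to move.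
data MakerWinsM {n : ℕ} (b : ℕ) (M B : Graph n) : Set
data MakerWinsB {n : ℕ} (b : ℕ) (M B : Graph n) : Set

data MakerWinsM {n} b M B where
  over : AllClaimed M B → Connected M → MakerWinsM b M B
  move : (e : Edge n) → Unclaimed M B e → MakerWinsB b (e ∷ M) B → MakerWinsM b M B

data MakerWinsB {n} b M B where
  over : AllClaimed M B → Connected M → MakerWinsB b M B
  move : (Σ (Edge n) (Unclaimed M B))
       → ((S : List (Edge n)) → BreakerMove b M B S → MakerWinsM b M (S ++ B))
       → MakerWinsB b M B

{-# OPTIONS --safe #-}

-- Maker grows a tree on the vertices 0, 1, …, k-1, attaching vertex k by an edge (u , k)
-- with u < k in her k-th move.  Every Breaker move is a matching, so it adds at most one
-- edge at any vertex; before her k-th move Breaker has moved only k-1 times, so at most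
-- k-1 of the k edges from {0, …, k-1} to k are his and one of them is still free.  Once
-- the tree spans all n vertices, Maker claims the remaining edges in any order.
module Submission where

open import Defs
open import Data.Nat using (ℕ; _≤_; _/_)
open import Data.List using ([])

open import Data.Nat using (zero; suc; _+_; _<_; z≤n; z<s; s≤s)
open import Data.Nat.Properties
  using (≤-reflexive; ≤-trans; <⇒≤; <-irrefl; +-comm; +-suc; +-monoˡ-≤; m<n+m; m<n⇒m<1+n;
         m<1+n⇒m<n∨m≡n; n<1⇒n≡0; module ≤-Reasoning)
open import Data.Fin using (Fin; toℕ; fromℕ<; inject≤; _<?_)
open import Data.Fin.Properties
  using (toℕ<n; toℕ-injective; toℕ-fromℕ<; toℕ-inject≤; inject≤-injective; pigeonhole; ¬∀⟶∃¬; <⇒≢)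
  renaming (_≟_ to _≟ᶠ_)
open import Data.Product using (Σ; _×_; _,_; proj₁; proj₂; ∃)
open import Data.Product.Properties using (≡-dec)
open import Data.Sum using (_⊎_; inj₁; inj₂)
open import Data.List using (List; _∷_; _++_; length; filter; lookup; allFin; cartesianProduct)
open import Data.List.Properties using (filter-++; filter-none; length-++)
open import Data.List.Membership.Propositional using (_∈_; _∉_)
open import Data.List.Membership.Propositional.Properties
  using (∈-filter⁺; ∈-++⁺ʳ; ∈-cartesianProduct⁺; ∈-allFin)
open import Data.List.Relation.Unary.Any using (here; there; index)
open import Data.List.Relation.Unary.Any.Properties using (lookup-index)
import Data.List.Relation.Unary.All as All
open import Data.List.Relation.Unary.AllPairs using (AllPairs; []; _∷_)
open import Function using (_∘_)
open import Function.Definitions using (Injective)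
open import Relation.Binary.Definitions using (DecidableEquality)
open import Relation.Binary.PropositionalEquality
  using (_≡_; _≢_; refl; sym; trans; cong; subst; module ≡-Reasoning)
open import Relation.Nullary using (¬_; yes; no; ¬?; _×-dec_; contradiction)
open import Relation.Unary using (Decidable; _⊆_)

module _ {a} {A : Set a} (_≟_ : DecidableEquality A) where
  open import Data.List.Membership.DecPropositional _≟_ using (_∈?_)

  injective⇒∃∉ : ∀ {k} (xs : List A) → length xs < k →
                 (f : Fin k → A) → Injective _≡_ _≡_ f → ∃ λ i → f i ∉ xs
  injective⇒∃∉ xs xs<k f f-injective = ¬∀⟶∃¬ _ (λ i → f i ∈ xs) (λ i → f i ∈? xs) notAll
    where
    notAll : ¬ (∀ i → f i ∈ xs)
    notAll f∈xs with pigeonhole xs<k (index ∘ f∈xs)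
    ... | i , j , i<j , sameIndex = <⇒≢ i<j (f-injective (begin
      f i                        ≡⟨ lookup-index (f∈xs i) ⟩
      lookup xs (index (f∈xs i)) ≡⟨ cong (lookup xs) sameIndex ⟩
      lookup xs (index (f∈xs j)) ≡⟨ lookup-index (f∈xs j) ⟨
      f j                        ∎))
      where open ≡-Reasoning

module _ {n : ℕ} where

  _≟ₑ_ : DecidableEquality (Edge n)
  _≟ₑ_ = ≡-dec _≟ᶠ_ _≟ᶠ_

  open import Data.List.Membership.DecPropositional _≟ₑ_ using (_∈?_)

  reach-weaken : ∀ {G : Graph n} {e x y} → Reach G x y → Reach (e ∷ G) x y
  reach-weaken here      = here
  reach-weaken (fwd m r) = fwd (there m) (reach-weaken r)
  reach-weaken (bwd m r) = bwd (there m) (reach-weaken r)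

  reach-trans : ∀ {G : Graph n} {x y z} → Reach G x y → Reach G y z → Reach G x z
  reach-trans here      r′ = r′
  reach-trans (fwd m r) r′ = fwd m (reach-trans r r′)
  reach-trans (bwd m r) r′ = bwd m (reach-trans r r′)

  reach-sym : ∀ {G : Graph n} {x y} → Reach G x y → Reach G y x
  reach-sym here      = here
  reach-sym (fwd m r) = reach-trans (reach-sym r) (bwd m here)
  reach-sym (bwd m r) = reach-trans (reach-sym r) (fwd m here)

  unclaimed? : (M B : Graph n) → Decidable (Unclaimed M B)
  unclaimed? M B (u , w) = (u <? w) ×-dec ¬? ((u , w) ∈? M) ×-dec ¬? ((u , w) ∈? B)

  unclaimed-∷ : ∀ {M B : Graph n} {e} → Unclaimed (e ∷ M) B ⊆ Unclaimed M B
  unclaimed-∷ (e<e′ , ∉e∷M , ∉B) = e<e′ , ∉e∷M ∘ there , ∉B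

  unclaimed-++ : ∀ {M B : Graph n} S → Unclaimed M (S ++ B) ⊆ Unclaimed M B
  unclaimed-++ S (isEdge , ∉M , ∉S++B) = isEdge , ∉M , ∉S++B ∘ ∈-++⁺ʳ S

  endsAt? : (v : Fin n) → Decidable (λ (e : Edge n) → proj₂ e ≡ v)
  endsAt? v e = proj₂ e ≟ᶠ v

  edgesInto : Graph n → Fin n → Graph n
  edgesInto G v = filter (endsAt? v) G

  indegree : Graph n → Fin n → ℕ
  indegree G v = length (edgesInto G v)

  indegree≤1-matching : ∀ {S} → AllPairs Disjoint S → ∀ v → indegree S v ≤ 1
  indegree≤1-matching [] v = z≤n
  indegree≤1-matching {(u , w) ∷ S} (disjoint ∷ matching) v with w ≟ᶠ v
  ... | yes refl = s≤s (≤-reflexive (cong length (filter-none (endsAt? w) (All.map otherEnd disjoint))))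
    where
    otherEnd : ∀ {e} → Disjoint (u , w) e → proj₂ e ≢ w
    otherEnd (_ , _ , _ , w≢) = w≢ ∘ sym
  ... | no _ = indegree≤1-matching matching v

  indegree-++-matching : ∀ {S} → AllPairs Disjoint S → ∀ B v → indegree (S ++ B) v ≤ suc (indegree B v)
  indegree-++-matching {S} matching B v = begin
    length (edgesInto (S ++ B) v)           ≡⟨ cong length (filter-++ (endsAt? v) S B) ⟩
    length (edgesInto S v ++ edgesInto B v) ≡⟨ length-++ (edgesInto S v) ⟩
    indegree S v + indegree B v             ≤⟨ +-monoˡ-≤ _ (indegree≤1-matching matching v) ⟩
    suc (indegree B v)                      ∎
    where open ≤-Reasoning

  EndsBelow : ℕ → Graph n → Set
  EndsBelow k M = ∀ {u w} → (u , w) ∈ M → toℕ w < k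

  freeEdgeInto : ∀ {k M B} (k<n : k < n) → EndsBelow k M → indegree B (fromℕ< k<n) < k →
                 ∃ λ u → toℕ u < k × Unclaimed M B (u , fromℕ< k<n)
  freeEdgeInto {k} {M} {B} k<n endsBelow fewInto =
    free (injective⇒∃∉ _≟ₑ_ (edgesInto B v) fewInto edge (inject≤-injective k≤n k≤n _ _ ∘ cong proj₁))
    where
    k≤n = <⇒≤ k<n
    v = fromℕ< k<n

    edge : Fin k → Edge n
    edge i = inject≤ i k≤n , v

    free : (∃ λ i → edge i ∉ edgesInto B v) → ∃ λ u → toℕ u < k × Unclaimed M B (u , v)
    free (i , ∉into) = u , u<k , u<v , <-irrefl (toℕ-fromℕ< k<n) ∘ endsBelow
                     , ∉into ∘ λ ∈B → ∈-filter⁺ (endsAt? v) ∈B refl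
      where
      u = inject≤ i k≤n

      u<k : toℕ u < k
      u<k = subst (_< k) (sym (toℕ-inject≤ i k≤n)) (toℕ<n i)

      u<v : toℕ u < toℕ v
      u<v = subst (toℕ u <_) (sym (toℕ-fromℕ< k<n)) u<k

  record ConnectedBelow (k : ℕ) (M : Graph n) : Set where
    field
      connected : ∀ x y → toℕ x < k → toℕ y < k → Reach M x y
      endsBelow : EndsBelow k M

  open ConnectedBelow public

  connectedBelow-attach : ∀ {k M u v} → ConnectedBelow k M → toℕ u < k → toℕ v ≡ k →
                          ConnectedBelow (suc k) ((u , v) ∷ M)
  connectedBelow-attach {k} {M} {u} {v} T u<k v≡k = record
    { connected = λ x y x<1+k y<1+k → reach-trans (reachesU x x<1+k) (reach-sym (reachesU y y<1+k))
    ; endsBelow = λ { (here refl) → ≤-reflexive (cong suc v≡k)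
                    ; (there ∈M)  → m<n⇒m<1+n (endsBelow T ∈M) }
    }
    where
    reachesU : ∀ x → toℕ x < suc k → Reach ((u , v) ∷ M) x u
    reachesU x x<1+k with m<1+n⇒m<n∨m≡n x<1+k
    ... | inj₁ x<k = reach-weaken (connected T x u x<k u<k)
    ... | inj₂ x≡k with toℕ-injective (trans x≡k (sym v≡k))
    ...   | refl = bwd (here refl) here

  connectedBelow⇒connected : ∀ {k M} → n ≤ k → ConnectedBelow k M → Connected M
  connectedBelow⇒connected n≤k T x y =
    connected T x y (≤-trans (toℕ<n x) n≤k) (≤-trans (toℕ<n y) n≤k)

  Covers : List (Edge n) → Graph n → Graph n → Set
  Covers L M B = Unclaimed M B ⊆ (_∈ L)

  covers-[] : ∀ {M B} → Covers [] M B → AllClaimed M B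
  covers-[] {M} {B} cov e isEdge with e ∈? M | e ∈? B
  ... | yes ∈M | _      = inj₁ ∈M
  ... | no _   | yes ∈B = inj₂ ∈B
  ... | no ∉M  | no ∉B  with cov (isEdge , ∉M , ∉B)
  ...   | ()

  covers-∷ : ∀ {e L M B} → Covers (e ∷ L) M B → ¬ Unclaimed M B e → Covers L M B
  covers-∷ cov claimed free with cov free
  ... | here refl = contradiction free claimed
  ... | there ∈L  = ∈L

  covers-claim : ∀ {e L M B} → Covers (e ∷ L) M B → Covers L (e ∷ M) B
  covers-claim cov = covers-∷ (cov ∘ unclaimed-∷) λ (_ , ∉e∷M , _) → ∉e∷M (here refl)

  unclaimedOrAllClaimed : ∀ L {M B} → Covers L M B → Σ (Edge n) (Unclaimed M B) ⊎ AllClaimed M B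
  unclaimedOrAllClaimed []      cov = inj₂ (covers-[] cov)
  unclaimedOrAllClaimed (e ∷ L) {M} {B} cov with unclaimed? M B e
  ... | yes free   = inj₁ (e , free)
  ... | no claimed = unclaimedOrAllClaimed L (covers-∷ cov claimed)

  allEdges : List (Edge n)
  allEdges = cartesianProduct (allFin n) (allFin n)

  covers-allEdges : ∀ {M B} → Covers allEdges M B
  covers-allEdges {x = u , w} _ = ∈-cartesianProduct⁺ (∈-allFin u) (∈-allFin w)

connectedBelow-1 : ∀ {m} → ConnectedBelow {suc m} 1 []
connectedBelow-1 = record
  { connected = λ x y x<1 y<1 →
      subst (Reach [] x) (toℕ-injective (trans (n<1⇒n≡0 x<1) (sym (n<1⇒n≡0 y<1)))) here
  ; endsBelow = λ ()
  }

module _ {n : ℕ} (b : ℕ) where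

  finishM : ∀ L {M B : Graph n} → Covers L M B → Connected M → MakerWinsM b M B
  finishB : ∀ L {M B : Graph n} → Covers L M B → Connected M → MakerWinsB b M B

  finishM []      cov connected = over (covers-[] cov) connected
  finishM (e ∷ L) {M} {B} cov connected with unclaimed? M B e
  ... | yes free   = move e free (finishB L (covers-claim cov) (λ x y → reach-weaken (connected x y)))
  ... | no claimed = finishM L (covers-∷ cov claimed) connected

  finishB L cov connected with unclaimedOrAllClaimed L cov
  ... | inj₁ free = move free λ S _ → finishM L (cov ∘ unclaimed-++ S) connected
  ... | inj₂ done = over done connected

  growM : ∀ d k {M B : Graph n} → d + k ≡ n → ConnectedBelow k M →
          (∀ v → indegree B v < k) → MakerWinsM b M B
  growB : ∀ d k {M B : Graph n} → d + suc k ≡ n → ConnectedBelow (suc k) M →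
          (∀ v → indegree B v < k) → MakerWinsB b M B

  growM zero k k≡n T _ =
    finishM allEdges covers-allEdges (connectedBelow⇒connected (≤-reflexive (sym k≡n)) T)
  growM (suc d) k eq T few =
    let u , u<k , free = freeEdgeInto k<n (endsBelow T) (few _) in
    move _ free (growB d k (trans (+-suc d k) eq) (connectedBelow-attach T u<k (toℕ-fromℕ< k<n)) few)
    where k<n = subst (k <_) eq (m<n+m k z<s)

  growB zero k 1+k≡n T _ =
    finishB allEdges covers-allEdges (connectedBelow⇒connected (≤-reflexive (sym 1+k≡n)) T)
  growB (suc d) k eq T few =
    move (_ , proj₂ (proj₂ (freeEdgeInto 1+k<n (endsBelow T) (m<n⇒m<1+n (few _)))))
      λ S (_ , _ , matching) →
        growM (suc d) (suc k) eq T λ v → s≤s (≤-trans (indegree-++-matching matching _ v) (few v))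
    where 1+k<n = subst (suc k <_) eq (m<n+m (suc k) z<s)

proposition4p2 : (n b : ℕ) → b ≤ n / 2 → MakerWinsM {n} b [] []
proposition4p2 zero    b _ = finishM b allEdges covers-allEdges (λ ())
proposition4p2 (suc n) b _ = growM b n 1 (+-comm n 1) connectedBelow-1 (λ _ → z<s)
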